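{- For integers $m_1,m_2\ge 0$ define polynomials $g_{m_1,m_2}(q)$ by $g_{0,0}(q)=1$, $g_{m_1,m_2}(q)=0$ if $m_1<0$ or $m_2<0$, and \[ g_{m_1,m_2}(q)=q^{\delta(c,m_1)}g_{m_1-1,m_2}(q)+g_{m_1,m_2-1}(q),\qquad (m_1,m_2)\ne(0,0),\ m_1,m_2\ge0, \] where $c=\lfloor\frac{m_1+m_2}{2}\rfloor+1$ and $\delta$ is the Kronecker delta. Then the weighted sample paths from $(m_1,m_2)$ to $(0,0)$ with steps $(-1,0)$ and $(0,-1)$, where a step $(-1,0)$ taken from a point $(a,b)$ carries weight $q$ if $a=\lfloor\frac{a+b}{2}\rfloor+1$ (and weight $1$ otherwise) and steps $(0,-1)$ carry weight $1$, are in weight-preserving bijection with the lattice paths of length $m_1+m_2$ with steps $(1,1)$ and $(1,-1)$ starting at $(0,0)$ and ending at $(m_1+m_2,\,m_2-m_1)$, where each such path is weighted by $q^{N}$ with $N$ the number of downward steps $(1,-1)$ that end at height $-1$ or at height $-2$. In particular, \[ g_{m_1,m_2}(q)=\sum_{p} q^{N(p)}, \] the sum running over all such lattice paths $p$ from $(0,0)$ to $(m_1+m_2,m_2-m_1)$. -}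

module Defs where

open import Data.Bool using (Bool; true; false; if_then_else_)
open import Data.Nat using (ℕ; zero; suc; _+_; _∸_; ⌊_/2⌋; _≡ᵇ_; _≤ᵇ_)
open import Data.Integer as ℤ using (ℤ; +_; -[1+_])
import Data.Integer.Properties as ℤP
open import Data.List using (List; []; _∷_; concatMap; filter; foldr; map)
open import Data.Vec using (Vec; []; _∷_)
open import Data.Product using (Σ)
open import Relation.Binary.PropositionalEquality using (_≡_)

kron : ℕ → ℕ → ℕ
kron x y = if x ≡ᵇ y then 1 else 0

-- Polynomials in q with ℕ coefficients, as coefficient functions (k ↦ coeff of q^k).
Poly : Set
Poly = ℕ → ℕ

zeroP : Poly
zeroP _ = 0

oneP : Poly
oneP k = kron k 0

monoP : ℕ → Poly
monoP e k = kron k e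

_+P_ : Poly → Poly → Poly
(p +P r) k = p k + r k
infixl 6 _+P_

qPow* : ℕ → Poly → Poly
qPow* e p k = if e ≤ᵇ k then p (k ∸ e) else 0

dexp : ℕ → ℕ → ℕ
dexp m₁ m₂ = kron (suc ⌊ (m₁ + m₂) /2⌋) m₁

-- g_{m1,m2}(q); the terms with a negative index are 0
g : ℕ → ℕ → Poly
g zero    zero    = oneP
g (suc a) zero    = qPow* (dexp (suc a) zero) (g a zero) +P zeroP
g zero    (suc b) = zeroP +P g zero b
g (suc a) (suc b) = qPow* (dexp (suc a) (suc b)) (g a (suc b)) +P g (suc a) b

data SPath : ℕ → ℕ → Set where
  done  : SPath 0 0
  stepL : ∀ {a b} → SPath a b → SPath (suc a) b
  stepD : ∀ {a b} → SPath a b → SPath a (suc b)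

leftExp : ℕ → ℕ → ℕ
leftExp a b = kron a (suc ⌊ (a + b) /2⌋)

sWeight : ∀ {a b} → SPath a b → ℕ
sWeight done = 0
sWeight (stepL {a} {b} p) = leftExp (suc a) b + sWeight p
sWeight (stepD p) = sWeight p

data Step : Set where
  up dn : Step

endH : ∀ {n} → ℤ → Vec Step n → ℤ
endH h [] = h
endH h (up ∷ v) = endH (h ℤ.+ ℤ.1ℤ) v
endH h (dn ∷ v) = endH (h ℤ.- ℤ.1ℤ) v

isTarget : ℤ → ℕ
isTarget -[1+ 0 ] = 1
isTarget -[1+ 1 ] = 1
isTarget _ = 0

countN : ∀ {n} → ℤ → Vec Step n → ℕ
countN h [] = 0
countN h (up ∷ v) = countN (h ℤ.+ ℤ.1ℤ) v
countN h (dn ∷ v) = isTarget (h ℤ.- ℤ.1ℤ) + countN (h ℤ.- ℤ.1ℤ) v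

NW : ∀ {n} → Vec Step n → ℕ
NW v = countN (+ 0) v

LPath : ℕ → ℕ → Set
LPath m₁ m₂ = Σ (Vec Step (m₁ + m₂)) λ v → endH (+ 0) v ≡ (+ m₂) ℤ.- (+ m₁)

allVecs : (n : ℕ) → List (Vec Step n)
allVecs zero = [] ∷ []
allVecs (suc n) = concatMap (λ v → (up ∷ v) ∷ (dn ∷ v) ∷ []) (allVecs n)

lpaths : (m₁ m₂ : ℕ) → List (Vec Step (m₁ + m₂))
lpaths m₁ m₂ = filter (λ v → endH (+ 0) v ℤ.≟ ((+ m₂) ℤ.- (+ m₁))) (allVecs (m₁ + m₂))

pathSum : ℕ → ℕ → Poly
pathSum m₁ m₂ = foldr _+P_ zeroP (map (λ v → monoP (NW v)) (lpaths m₁ m₂))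

-- Read from (0,0) back to (m₁,m₂), a sample path is a lattice path in which a step (-1,0)
-- becomes a down step and a step (0,-1) an up step; after a steps of the first kind and b of
-- the second, the lattice path is at height b - a. So the step (-1,0) from (a,b) is the down
-- step ending at height b - a, and b - a ∈ {-1,-2} holds exactly when a = ⌊(a+b)/2⌋ + 1: the
-- weights agree. For the polynomial identity, sorting lattice paths by their last step shows
-- that the generating polynomials of walks by length and final height satisfy the recursion
-- of g, the terms of g with a negative index corresponding to heights out of reach.
module Submission where

open import Defs
open import Data.Bool using (true; false; if_then_else_)
open import Data.Empty using (⊥-elim)
import Data.Empty.Irrelevant as Irrelevant
open import Data.Integer as ℤ using (ℤ; +_; 1ℤ; ∣_∣; _≟_)
import Data.Integer.Properties as ℤP
open import Data.Integer.Tactic.RingSolver using (solve-∀)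
open import Data.List using (List; []; _∷_; _++_; concatMap; filter; foldr; map)
open import Data.Nat as ℕ using (ℕ; zero; suc; _+_; _∸_; _≤ᵇ_; ⌊_/2⌋)
import Data.Nat.Properties as ℕP
open import Data.Product using (Σ; _×_; _,_; proj₁)
open import Data.Vec using (Vec; []; _∷_; _∷ʳ_; cast; reverse)
open import Data.Vec.Properties using (reverse-∷; reverse-involutive; cast-reverse; cast-sym)
open import Data.Vec.Relation.Binary.Equality.Cast using (cast-is-id)
open import Function using (_∘_)
open import Function.Bundles using (_⤖_; Bijection; mk↔ₛ′)
open import Function.Properties.Inverse using (↔⇒⤖)
open import Relation.Binary.PropositionalEquality
open import Relation.Nullary using (Dec; does; yes; no; ofʸ; ofⁿ)
open import Relation.Nullary.Decidable using (dec-true; dec-false)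
import Axiom.UniquenessOfIdentityProofs as UIP
import Relation.Binary.Reasoning.Setoid as SetoidReasoning
open import Algebra.Properties.CommutativeSemigroup ℕP.+-commutativeSemigroup
  using (interchange)

private
  variable
    a b n : ℕ
    A : Set

stepH : ℤ → Step → ℤ
stepH h up = h ℤ.+ 1ℤ
stepH h dn = h ℤ.- 1ℤ

unstepH : ℤ → Step → ℤ
unstepH h up = h ℤ.- 1ℤ
unstepH h dn = h ℤ.+ 1ℤ

stepH-unstepH : ∀ h x → stepH (unstepH h x) x ≡ h
stepH-unstepH h up = lemma h
  where lemma : ∀ h → (h ℤ.- 1ℤ) ℤ.+ 1ℤ ≡ h
        lemma = solve-∀
stepH-unstepH h dn = lemma h
  where lemma : ∀ h → (h ℤ.+ 1ℤ) ℤ.- 1ℤ ≡ h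
        lemma = solve-∀

unstepH-stepH : ∀ h x → unstepH (stepH h x) x ≡ h
unstepH-stepH h up = stepH-unstepH h dn
unstepH-stepH h dn = stepH-unstepH h up

stepH≡⇒≡unstepH : ∀ {z h} x → stepH z x ≡ h → z ≡ unstepH h x
stepH≡⇒≡unstepH {z} x refl = sym (unstepH-stepH z x)

endH-∷ : ∀ h x (w : Vec Step n) → endH h (x ∷ w) ≡ endH (stepH h x) w
endH-∷ h up w = refl
endH-∷ h dn w = refl

endH-∷ʳ : ∀ h (w : Vec Step n) x → endH h (w ∷ʳ x) ≡ stepH (endH h w) x
endH-∷ʳ h []       up = refl
endH-∷ʳ h []       dn = refl
endH-∷ʳ h (up ∷ w) x  = endH-∷ʳ (h ℤ.+ 1ℤ) w x
endH-∷ʳ h (dn ∷ w) x  = endH-∷ʳ (h ℤ.- 1ℤ) w x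

∣stepH∣≤ : ∀ h x → ∣ stepH h x ∣ ℕ.≤ ∣ h ∣ + 1
∣stepH∣≤ h up = ℤP.∣i+j∣≤∣i∣+∣j∣ h 1ℤ
∣stepH∣≤ h dn = ℤP.∣i+j∣≤∣i∣+∣j∣ h (ℤ.- 1ℤ)

∣endH∣≤ : ∀ h (w : Vec Step n) → ∣ endH h w ∣ ℕ.≤ ∣ h ∣ + n
∣endH∣≤ h [] = ℕP.m≤m+n ∣ h ∣ 0
∣endH∣≤ {suc n} h (x ∷ w) = begin
  ∣ endH h (x ∷ w) ∣      ≡⟨ cong ∣_∣ (endH-∷ h x w) ⟩
  ∣ endH (stepH h x) w ∣ ≤⟨ ∣endH∣≤ (stepH h x) w ⟩
  ∣ stepH h x ∣ + n      ≤⟨ ℕP.+-monoˡ-≤ n (∣stepH∣≤ h x) ⟩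
  ∣ h ∣ + 1 + n          ≡⟨ ℕP.+-assoc ∣ h ∣ 1 n ⟩
  ∣ h ∣ + suc n          ∎
  where open ℕP.≤-Reasoning

endH-unreachable : ∀ (w : Vec Step n) {h} → n ℕ.< ∣ h ∣ → endH (+ 0) w ≢ h
endH-unreachable w n<∣h∣ refl = ℕP.<⇒≱ n<∣h∣ (∣endH∣≤ (+ 0) w)

stepWeight : Step → ℤ → ℕ
stepWeight up _ = 0
stepWeight dn h = isTarget h

countN-∷ʳ : ∀ h (w : Vec Step n) x →
            countN h (w ∷ʳ x) ≡ countN h w + stepWeight x (endH h (w ∷ʳ x))
countN-∷ʳ h []       up = refl
countN-∷ʳ h []       dn = ℕP.+-identityʳ _
countN-∷ʳ h (up ∷ w) x  = countN-∷ʳ (h ℤ.+ 1ℤ) w x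
countN-∷ʳ h (dn ∷ w) x  = trans (cong (t ℕ.+_) (countN-∷ʳ (h ℤ.- 1ℤ) w x)) (sym (ℕP.+-assoc t _ _))
  where t = isTarget (h ℤ.- 1ℤ)

cast-invariant : ∀ {X : Set} (f : ∀ {k} → Vec Step k → X) {m} (e : m ≡ n) (v : Vec Step m) →
                 f (cast e v) ≡ f v
cast-invariant f refl v = cong f (cast-is-id refl v)

finalHeight : ℕ → ℕ → ℤ
finalHeight m₁ m₂ = + m₂ ℤ.- + m₁

finalHeight-predˡ : ∀ a b → unstepH (finalHeight (suc a) b) dn ≡ finalHeight a b
finalHeight-predˡ a b = lemma (+ a) (+ b)
  where lemma : ∀ x y → (y ℤ.- (1ℤ ℤ.+ x)) ℤ.+ 1ℤ ≡ y ℤ.- x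
        lemma = solve-∀

finalHeight-predʳ : ∀ a b → unstepH (finalHeight a (suc b)) up ≡ finalHeight a b
finalHeight-predʳ a b = lemma (+ a) (+ b)
  where lemma : ∀ x y → ((1ℤ ℤ.+ y) ℤ.- x) ℤ.- 1ℤ ≡ y ℤ.- x
        lemma = solve-∀

finalHeight-sucˡ : ∀ a b → stepH (finalHeight a b) dn ≡ finalHeight (suc a) b
finalHeight-sucˡ a b = trans (cong (λ h → stepH h dn) (sym (finalHeight-predˡ a b)))
                             (stepH-unstepH (finalHeight (suc a) b) dn)

finalHeight-sucʳ : ∀ a b → stepH (finalHeight a b) up ≡ finalHeight a (suc b)
finalHeight-sucʳ a b = trans (cong (λ h → stepH h up) (sym (finalHeight-predʳ a b)))
                             (stepH-unstepH (finalHeight a (suc b)) up)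

-- A path to (a+1, -(a+1)) has only down steps and a path to (b+1, b+1) only up steps:
-- undoing a last step of the other kind gives a height its first a (resp. b) steps cannot reach.
floor-unreachable : ∀ a → a + 0 ℕ.< ∣ unstepH (finalHeight (suc a) 0) up ∣
floor-unreachable a = ℕP.m<n⇒m<1+n (ℕP.n<1+n (a + 0))

ceiling-unreachable : ∀ b → b ℕ.< ∣ unstepH (finalHeight 0 (suc b)) dn ∣
ceiling-unreachable b = ℕ.s≤s (ℕP.≤-trans (ℕP.m≤m+n b 0) (ℕP.m≤m+n (b + 0) 1))

kron-≢ : ∀ {x y} → x ≢ y → kron x y ≡ 0
kron-≢ {zero}  {zero}  x≢y = ⊥-elim (x≢y refl)
kron-≢ {zero}  {suc y} x≢y = refl
kron-≢ {suc x} {zero}  x≢y = refl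
kron-≢ {suc x} {suc y} x≢y = kron-≢ (x≢y ∘ cong suc)

kron-sym : ∀ x y → kron x y ≡ kron y x
kron-sym zero    zero    = refl
kron-sym zero    (suc y) = refl
kron-sym (suc x) zero    = refl
kron-sym (suc x) (suc y) = kron-sym x y

kron-+ : ∀ e x y → kron (e + x) (e + y) ≡ kron x y
kron-+ zero    x y = refl
kron-+ (suc e) x y = kron-+ e x y

-- b - (a+1) ∈ {-1, -2} iff b ∈ {a, a-1} iff a = ⌊(a+1+b)/2⌋.
isTarget-finalHeight : ∀ a b → isTarget (finalHeight (suc a) b) ≡ leftExp (suc a) b
isTarget-finalHeight zero          zero    = refl
isTarget-finalHeight zero          (suc b) = refl
isTarget-finalHeight (suc zero)    zero    = refl
isTarget-finalHeight (suc (suc a)) zero    = sym (kron-≢ (ℕP.<⇒≢ ⌊a+1/2⌋<a+1 ∘ sym))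
  where ⌊a+1/2⌋<a+1 : ⌊ suc (a + 0) /2⌋ ℕ.< suc a
        ⌊a+1/2⌋<a+1 = subst (λ n → ⌊ suc (a + 0) /2⌋ ℕ.< suc n) (ℕP.+-identityʳ a)
                            (ℕP.⌊n/2⌋<n (a + 0))
isTarget-finalHeight (suc a)       (suc b) = begin
  isTarget (finalHeight (suc (suc a)) (suc b))
    ≡⟨ cong isTarget (ℤP.[1+m]⊖[1+n]≡m⊖n b (suc a)) ⟩
  isTarget (finalHeight (suc a) b)
    ≡⟨ isTarget-finalHeight a b ⟩
  kron a ⌊ suc (a + b) /2⌋
    ≡⟨ cong (λ n → kron a ⌊ n /2⌋) (sym (ℕP.+-suc a b)) ⟩
  kron a ⌊ a + suc b /2⌋
    ∎
  where open ≡-Reasoning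

dexp≡isTarget : ∀ a b → dexp (suc a) b ≡ isTarget (finalHeight (suc a) b)
dexp≡isTarget a b =
  trans (kron-sym (suc ⌊ suc a + b /2⌋) (suc a)) (sym (isTarget-finalHeight a b))

-- The bijection

steps : SPath a b → Vec Step (a + b)
steps done                  = []
steps (stepL p)             = dn ∷ steps p
steps (stepD {a} {b} p)     = cast (sym (ℕP.+-suc a b)) (up ∷ steps p)

latticePath : SPath a b → Vec Step (a + b)
latticePath = reverse ∘ steps

latticePath-stepL : (p : SPath a b) → latticePath (stepL p) ≡ latticePath p ∷ʳ dn
latticePath-stepL p = reverse-∷ dn (steps p)

latticePath-stepD : (p : SPath a b) →
                    latticePath (stepD p) ≡ cast (sym (ℕP.+-suc a b)) (latticePath p ∷ʳ up)
latticePath-stepD {a} {b} p = begin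
  reverse (cast e (up ∷ steps p)) ≡⟨ cast-reverse e (up ∷ steps p) ⟨
  cast e (reverse (up ∷ steps p)) ≡⟨ cong (cast e) (reverse-∷ up (steps p)) ⟩
  cast e (latticePath p ∷ʳ up)    ∎
  where open ≡-Reasoning
        e = sym (ℕP.+-suc a b)

endH-latticePath : (p : SPath a b) → endH (+ 0) (latticePath p) ≡ finalHeight a b
endH-latticePath done = refl
endH-latticePath (stepL {a} {b} p) = begin
  endH (+ 0) (latticePath (stepL p))    ≡⟨ cong (endH (+ 0)) (latticePath-stepL p) ⟩
  endH (+ 0) (latticePath p ∷ʳ dn)      ≡⟨ endH-∷ʳ (+ 0) (latticePath p) dn ⟩
  stepH (endH (+ 0) (latticePath p)) dn ≡⟨ cong (λ h → stepH h dn) (endH-latticePath p) ⟩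
  stepH (finalHeight a b) dn            ≡⟨ finalHeight-sucˡ a b ⟩
  finalHeight (suc a) b                 ∎
  where open ≡-Reasoning
endH-latticePath (stepD {a} {b} p) = begin
  endH (+ 0) (latticePath (stepD p))    ≡⟨ cong (endH (+ 0)) (latticePath-stepD p) ⟩
  endH (+ 0) (cast e (latticePath p ∷ʳ up))
                                        ≡⟨ cast-invariant (endH (+ 0)) e _ ⟩
  endH (+ 0) (latticePath p ∷ʳ up)      ≡⟨ endH-∷ʳ (+ 0) (latticePath p) up ⟩
  stepH (endH (+ 0) (latticePath p)) up ≡⟨ cong (λ h → stepH h up) (endH-latticePath p) ⟩
  stepH (finalHeight a b) up            ≡⟨ finalHeight-sucʳ a b ⟩
  finalHeight a (suc b)                 ∎
  where open ≡-Reasoning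
        e = sym (ℕP.+-suc a b)

-- The last lattice step is the first sample step, so it is paid for at the final height.
NW-latticePath : (p : SPath a b) → NW (latticePath p) ≡ sWeight p
NW-latticePath done = refl
NW-latticePath (stepL {a} {b} p) = begin
  NW (latticePath (stepL p))
    ≡⟨ cong NW (latticePath-stepL p) ⟩
  NW (latticePath p ∷ʳ dn)
    ≡⟨ countN-∷ʳ (+ 0) (latticePath p) dn ⟩
  NW (latticePath p) + isTarget (endH (+ 0) (latticePath p ∷ʳ dn))
    ≡⟨ cong₂ _+_ (NW-latticePath p) (cong isTarget end) ⟩
  sWeight p + isTarget (finalHeight (suc a) b)
    ≡⟨ cong (sWeight p ℕ.+_) (isTarget-finalHeight a b) ⟩
  sWeight p + leftExp (suc a) b
    ≡⟨ ℕP.+-comm (sWeight p) _ ⟩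
  sWeight (stepL p)
    ∎
  where open ≡-Reasoning
        end : endH (+ 0) (latticePath p ∷ʳ dn) ≡ finalHeight (suc a) b
        end = trans (cong (endH (+ 0)) (sym (latticePath-stepL p))) (endH-latticePath (stepL p))
NW-latticePath (stepD {a} {b} p) = begin
  NW (latticePath (stepD p))         ≡⟨ cong NW (latticePath-stepD p) ⟩
  NW (cast e (latticePath p ∷ʳ up))  ≡⟨ cast-invariant NW e _ ⟩
  NW (latticePath p ∷ʳ up)           ≡⟨ countN-∷ʳ (+ 0) (latticePath p) up ⟩
  NW (latticePath p) + 0             ≡⟨ ℕP.+-identityʳ _ ⟩
  NW (latticePath p)                 ≡⟨ NW-latticePath p ⟩
  sWeight p                          ∎
  where open ≡-Reasoning
        e = sym (ℕP.+-suc a b)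

height-before : ∀ x (r : Vec Step n) {h} →
                endH (+ 0) (reverse (x ∷ r)) ≡ h → endH (+ 0) (reverse r) ≡ unstepH h x
height-before x r eq = stepH≡⇒≡unstepH x (begin
  stepH (endH (+ 0) (reverse r)) x ≡⟨ endH-∷ʳ (+ 0) (reverse r) x ⟨
  endH (+ 0) (reverse r ∷ʳ x)      ≡⟨ cong (endH (+ 0)) (reverse-∷ x r) ⟨
  endH (+ 0) (reverse (x ∷ r))     ≡⟨ eq ⟩
  _                                ∎)
  where open ≡-Reasoning

floor-¬up : (r : Vec Step (a + 0)) → endH (+ 0) (reverse (up ∷ r)) ≢ finalHeight (suc a) 0
floor-¬up {a} r eq = endH-unreachable (reverse r) (floor-unreachable a) (height-before up r eq)

ceiling-¬dn : (r : Vec Step b) → endH (+ 0) (reverse (dn ∷ r)) ≢ finalHeight 0 (suc b)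
ceiling-¬dn {b} r eq = endH-unreachable (reverse r) (ceiling-unreachable b) (height-before dn r eq)

height-after-stepL : ∀ a b (r : Vec Step n) →
                     endH (+ 0) (reverse (dn ∷ r)) ≡ finalHeight (suc a) b →
                     endH (+ 0) (reverse r) ≡ finalHeight a b
height-after-stepL a b r h = trans (height-before dn r h) (finalHeight-predˡ a b)

height-after-stepD : ∀ a b (r : Vec Step n) →
                     endH (+ 0) (reverse (up ∷ r)) ≡ finalHeight a (suc b) →
                     endH (+ 0) (reverse r) ≡ finalHeight a b
height-after-stepD a b r h = trans (height-before up r h) (finalHeight-predʳ a b)

endH-reverse-cast : ∀ {m} (e : m ≡ n) (r : Vec Step m) →
                    endH (+ 0) (reverse (cast e r)) ≡ endH (+ 0) (reverse r)
endH-reverse-cast = cast-invariant (endH (+ 0) ∘ reverse)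

fromSteps : ∀ a b (r : Vec Step (a + b)) →
            .(endH (+ 0) (reverse r) ≡ finalHeight a b) → SPath a b
fromSteps zero    zero    []       _ = done
fromSteps (suc a) b       (dn ∷ r) h = stepL (fromSteps a b r (height-after-stepL a b r h))
fromSteps (suc a) zero    (up ∷ r) h = Irrelevant.⊥-elim (floor-¬up r h)
fromSteps (suc a) (suc b) (up ∷ r) h = stepD (fromSteps (suc a) b (cast (ℕP.+-suc a b) r)
  (trans (endH-reverse-cast (ℕP.+-suc a b) r) (height-after-stepD (suc a) b r h)))
fromSteps zero    (suc b) (up ∷ r) h = stepD (fromSteps zero b r (height-after-stepD zero b r h))
fromSteps zero    (suc b) (dn ∷ r) h = Irrelevant.⊥-elim (ceiling-¬dn r h)

fromSteps-cong : ∀ {r r′ : Vec Step (a + b)} .{h h′} →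
                 r ≡ r′ → fromSteps a b r h ≡ fromSteps a b r′ h′
fromSteps-cong refl = refl

fromSteps-steps : (p : SPath a b) .(h : endH (+ 0) (reverse (steps p)) ≡ finalHeight a b) →
                  fromSteps a b (steps p) h ≡ p
fromSteps-steps done                  h = refl
fromSteps-steps (stepL p)             h = cong stepL (fromSteps-steps p (endH-latticePath p))
fromSteps-steps (stepD {zero}  {b} p) h =
  cong stepD (trans (fromSteps-cong (cast-is-id refl (steps p)))
                    (fromSteps-steps p (endH-latticePath p)))
fromSteps-steps (stepD {suc a} {b} p) h =
  cong stepD (trans (fromSteps-cong (cast-sym (sym (ℕP.+-suc a b)) refl))
                    (fromSteps-steps p (endH-latticePath p)))

steps-fromSteps : ∀ a b (r : Vec Step (a + b)) (h : endH (+ 0) (reverse r) ≡ finalHeight a b) →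
                  steps (fromSteps a b r h) ≡ r
steps-fromSteps zero    zero    []       h = refl
steps-fromSteps (suc a) b       (dn ∷ r) h =
  cong (dn ∷_) (steps-fromSteps a b r (height-after-stepL a b r h))
steps-fromSteps (suc a) zero    (up ∷ r) h = ⊥-elim (floor-¬up r h)
steps-fromSteps (suc a) (suc b) (up ∷ r) h =
  cong (up ∷_) (trans (cong (cast (sym e)) (steps-fromSteps (suc a) b (cast e r) h′))
                      (cast-sym e refl))
  where e  = ℕP.+-suc a b
        h′ = trans (endH-reverse-cast e r) (height-after-stepD (suc a) b r h)
steps-fromSteps zero    (suc b) (up ∷ r) h =
  cong (up ∷_) (trans (cast-is-id refl _)
                      (steps-fromSteps zero b r (height-after-stepD zero b r h)))
steps-fromSteps zero    (suc b) (dn ∷ r) h = ⊥-elim (ceiling-¬dn r h)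

toLPath : SPath a b → LPath a b
toLPath p = latticePath p , endH-latticePath p

endH-reverse² : ∀ {h} (v : Vec Step n) →
                endH (+ 0) v ≡ h → endH (+ 0) (reverse (reverse v)) ≡ h
endH-reverse² v = trans (cong (endH (+ 0)) (reverse-involutive v))

fromLPath : LPath a b → SPath a b
fromLPath {a} {b} (v , h) = fromSteps a b (reverse v) (endH-reverse² v h)

LPath-≡ : {l l′ : LPath a b} → proj₁ l ≡ proj₁ l′ → l ≡ l′
LPath-≡ {l = v , h} {.v , h′} refl = cong (v ,_) (UIP.Decidable⇒UIP.≡-irrelevant _≟_ h h′)

toLPath-fromLPath : (l : LPath a b) → toLPath (fromLPath {a} {b} l) ≡ l
toLPath-fromLPath {a} {b} l@(v , h) = LPath-≡ {a} {b} (begin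
  reverse (steps (fromLPath {a} {b} l))
    ≡⟨ cong reverse (steps-fromSteps a b (reverse v) (endH-reverse² v h)) ⟩
  reverse (reverse v)
    ≡⟨ reverse-involutive v ⟩
  v ∎)
  where open ≡-Reasoning

fromLPath-toLPath : (p : SPath a b) → fromLPath (toLPath p) ≡ p
fromLPath-toLPath p =
  trans (fromSteps-cong (reverse-involutive (steps p))) (fromSteps-steps p (endH-latticePath p))

SPath⤖LPath : SPath a b ⤖ LPath a b
SPath⤖LPath {a} {b} =
  ↔⇒⤖ (mk↔ₛ′ toLPath fromLPath (toLPath-fromLPath {a} {b}) fromLPath-toLPath)

+P-cong : {p p′ r r′ : Poly} → p ≗ p′ → r ≗ r′ → p +P r ≗ p′ +P r′
+P-cong p≗p′ r≗r′ k = cong₂ _+_ (p≗p′ k) (r≗r′ k)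

+P-comm : (p r : Poly) → p +P r ≗ r +P p
+P-comm p r k = ℕP.+-comm (p k) (r k)

qPow*-cong : ∀ {e e′} {p p′ : Poly} → e ≡ e′ → p ≗ p′ → qPow* e p ≗ qPow* e′ p′
qPow*-cong {e} refl p≗p′ k with e ≤ᵇ k
... | true  = p≗p′ (k ∸ e)
... | false = refl

qPow*-zeroP : ∀ e → qPow* e zeroP ≗ zeroP
qPow*-zeroP e k with e ≤ᵇ k
... | true  = refl
... | false = refl

qPow*-+P : ∀ e (p r : Poly) → qPow* e (p +P r) ≗ qPow* e p +P qPow* e r
qPow*-+P e p r k with e ≤ᵇ k
... | true  = refl
... | false = refl

monoP-+ : ∀ n e → monoP (n + e) ≗ qPow* e (monoP n)
monoP-+ n e k with e ≤ᵇ k | ℕP.≤ᵇ-reflects-≤ e k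
... | true  | ofʸ e≤k = begin
  kron k (n + e)             ≡⟨ cong₂ kron (sym (ℕP.m+[n∸m]≡n e≤k)) (ℕP.+-comm n e) ⟩
  kron (e + (k ∸ e)) (e + n) ≡⟨ kron-+ e (k ∸ e) n ⟩
  kron (k ∸ e) n             ∎
  where open ≡-Reasoning
... | false | ofⁿ e≰k = kron-≢ λ k≡n+e → e≰k (subst (e ℕ.≤_) (sym k≡n+e) (ℕP.m≤n+m e n))

sumP : List A → (A → Poly) → Poly
sumP xs F = foldr _+P_ zeroP (map F xs)

sumP-cong : ∀ (xs : List A) {F G : A → Poly} → (∀ x → F x ≗ G x) → sumP xs F ≗ sumP xs G
sumP-cong []       F≗G k = refl
sumP-cong (x ∷ xs) F≗G k = cong₂ _+_ (F≗G x k) (sumP-cong xs F≗G k)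

sumP-zeroP : ∀ (xs : List A) {F : A → Poly} → (∀ x → F x ≗ zeroP) → sumP xs F ≗ zeroP
sumP-zeroP []       F≗0 k = refl
sumP-zeroP (x ∷ xs) F≗0 k = cong₂ _+_ (F≗0 x k) (sumP-zeroP xs F≗0 k)

sumP-++ : ∀ (xs ys : List A) F → sumP (xs ++ ys) F ≗ sumP xs F +P sumP ys F
sumP-++ []       ys F k = refl
sumP-++ (x ∷ xs) ys F k =
  trans (cong (F x k ℕ.+_) (sumP-++ xs ys F k)) (sym (ℕP.+-assoc (F x k) _ _))

sumP-concatMap : ∀ {B : Set} (f : A → List B) xs F →
                 sumP (concatMap f xs) F ≗ sumP xs (λ x → sumP (f x) F)
sumP-concatMap f []       F k = refl
sumP-concatMap f (x ∷ xs) F k =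
  trans (sumP-++ (f x) (concatMap f xs) F k)
        (cong (sumP (f x) F k ℕ.+_) (sumP-concatMap f xs F k))

sumP-+P : ∀ (xs : List A) F G → sumP xs (λ x → F x +P G x) ≗ sumP xs F +P sumP xs G
sumP-+P []       F G k = refl
sumP-+P (x ∷ xs) F G k =
  trans (cong (F x k + G x k ℕ.+_) (sumP-+P xs F G k)) (interchange (F x k) (G x k) _ _)

sumP-qPow* : ∀ (xs : List A) e F → sumP xs (λ x → qPow* e (F x)) ≗ qPow* e (sumP xs F)
sumP-qPow* []       e F k = sym (qPow*-zeroP e k)
sumP-qPow* (x ∷ xs) e F k =
  trans (cong (qPow* e (F x) k ℕ.+_) (sumP-qPow* xs e F k)) (sym (qPow*-+P e (F x) (sumP xs F) k))

sumP-filter : ∀ {P : A → Set} (P? : ∀ x → Dec (P x)) xs F →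
              sumP (filter P? xs) F ≗ sumP xs (λ x → if does (P? x) then F x else zeroP)
sumP-filter P? []       F k = refl
sumP-filter P? (x ∷ xs) F k with does (P? x)
... | true  = cong (F x k ℕ.+_) (sumP-filter P? xs F k)
... | false = sumP-filter P? xs F k

sumP-allVecs-∷ : ∀ n F →
                 sumP (allVecs (suc n)) F ≗ sumP (allVecs n) (λ v → F (up ∷ v) +P F (dn ∷ v))
sumP-allVecs-∷ n F k = trans (sumP-concatMap _ (allVecs n) F k)
  (sumP-cong (allVecs n) (λ v k → cong (F (up ∷ v) k ℕ.+_) (ℕP.+-identityʳ (F (dn ∷ v) k))) k)

sumP-allVecs-∷ʳ : ∀ n F →
                  sumP (allVecs (suc n)) F ≗ sumP (allVecs n) (λ w → F (w ∷ʳ up) +P F (w ∷ʳ dn))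
sumP-allVecs-∷ʳ zero    F = sumP-allVecs-∷ zero F
sumP-allVecs-∷ʳ (suc n) F = begin
  sumP (allVecs (suc (suc n))) F
    ≈⟨ sumP-allVecs-∷ (suc n) F ⟩
  sumP (allVecs (suc n)) (λ v → F (up ∷ v) +P F (dn ∷ v))
    ≈⟨ sumP-allVecs-∷ʳ n _ ⟩
  sumP (allVecs n) (λ w → (F (up ∷ (w ∷ʳ up)) +P F (dn ∷ (w ∷ʳ up)))
                       +P (F (up ∷ (w ∷ʳ dn)) +P F (dn ∷ (w ∷ʳ dn))))
    ≈⟨ sumP-cong (allVecs n) (λ w k → interchange (F (up ∷ (w ∷ʳ up)) k) _ _ _) ⟩
  sumP (allVecs n) (λ w → (F (up ∷ (w ∷ʳ up)) +P F (up ∷ (w ∷ʳ dn)))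
                       +P (F (dn ∷ (w ∷ʳ up)) +P F (dn ∷ (w ∷ʳ dn))))
    ≈⟨ sumP-allVecs-∷ n _ ⟨
  sumP (allVecs (suc n)) (λ w → F (w ∷ʳ up) +P F (w ∷ʳ dn))
    ∎
  where open SetoidReasoning (ℕ →-setoid ℕ)

-- The generating polynomial of walks by final height

walkTerm : ℤ → Vec Step n → Poly
walkTerm h v = if does (endH (+ 0) v ≟ h) then monoP (NW v) else zeroP

walkPoly : ℕ → ℤ → Poly
walkPoly n h = sumP (allVecs n) (walkTerm h)

pathSum≗walkPoly : ∀ m₁ m₂ → pathSum m₁ m₂ ≗ walkPoly (m₁ + m₂) (finalHeight m₁ m₂)
pathSum≗walkPoly m₁ m₂ =
  sumP-filter (λ v → endH (+ 0) v ≟ finalHeight m₁ m₂) (allVecs (m₁ + m₂)) (λ v → monoP (NW v))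

lastStepTerm : ∀ h x {E E′ N N′} → E′ ≡ stepH E x → N′ ≡ N + stepWeight x E′ →
               (if does (E′ ≟ h) then monoP N′ else zeroP)
                 ≗ qPow* (stepWeight x h) (if does (E ≟ unstepH h x) then monoP N else zeroP)
lastStepTerm h x {E} refl refl with E ≟ unstepH h x
... | yes refl rewrite stepH-unstepH h x | dec-true (h ≟ h) refl = monoP-+ _ (stepWeight x h)
... | no E≢   rewrite dec-false (stepH E x ≟ h) (E≢ ∘ stepH≡⇒≡unstepH x) =
  λ k → sym (qPow*-zeroP (stepWeight x h) k)

walkTerm-∷ʳ : ∀ h (w : Vec Step n) x →
              walkTerm h (w ∷ʳ x) ≗ qPow* (stepWeight x h) (walkTerm (unstepH h x) w)
walkTerm-∷ʳ h w x = lastStepTerm h x (endH-∷ʳ (+ 0) w x) (countN-∷ʳ (+ 0) w x)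

walkPoly-suc : ∀ n h → walkPoly (suc n) h
                         ≗ qPow* (isTarget h) (walkPoly n (h ℤ.+ 1ℤ)) +P walkPoly n (h ℤ.- 1ℤ)
walkPoly-suc n h = begin
  walkPoly (suc n) h
    ≈⟨ sumP-allVecs-∷ʳ n (walkTerm h) ⟩
  sumP (allVecs n) (λ w → walkTerm h (w ∷ʳ up) +P walkTerm h (w ∷ʳ dn))
    ≈⟨ sumP-+P (allVecs n) _ _ ⟩
  sumP (allVecs n) (walkTerm h ∘ (_∷ʳ up)) +P sumP (allVecs n) (walkTerm h ∘ (_∷ʳ dn))
    ≈⟨ +P-comm (sumP (allVecs n) (walkTerm h ∘ (_∷ʳ up))) _ ⟩
  sumP (allVecs n) (walkTerm h ∘ (_∷ʳ dn)) +P sumP (allVecs n) (walkTerm h ∘ (_∷ʳ up))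
    -- an up step has stepWeight 0, and qPow* 0 reduces to the identity
    ≈⟨ +P-cong (sumP-cong (allVecs n) (λ w → walkTerm-∷ʳ h w dn))
               (sumP-cong (allVecs n) (λ w → walkTerm-∷ʳ h w up)) ⟩
  sumP (allVecs n) (λ w → qPow* (isTarget h) (walkTerm (h ℤ.+ 1ℤ) w)) +P walkPoly n (h ℤ.- 1ℤ)
    ≈⟨ +P-cong (sumP-qPow* (allVecs n) (isTarget h) (walkTerm (h ℤ.+ 1ℤ))) (λ _ → refl) ⟩
  qPow* (isTarget h) (walkPoly n (h ℤ.+ 1ℤ)) +P walkPoly n (h ℤ.- 1ℤ)
    ∎
  where open SetoidReasoning (ℕ →-setoid ℕ)

walkPoly-unreachable : ∀ n h → n ℕ.< ∣ h ∣ → walkPoly n h ≗ zeroP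
walkPoly-unreachable n h n<∣h∣ = sumP-zeroP (allVecs n) λ w k →
  cong (λ t → (if t then monoP (NW w) else zeroP) k)
       (dec-false (endH (+ 0) w ≟ h) (endH-unreachable w n<∣h∣))

walkPoly-below-floor : ∀ a → zeroP ≗ walkPoly (a + 0) (finalHeight (suc a) 0 ℤ.- 1ℤ)
walkPoly-below-floor a k = sym (walkPoly-unreachable (a + 0) _ (floor-unreachable a) k)

walkPoly-above-ceiling : ∀ b → let h = finalHeight 0 (suc b) in
                         zeroP ≗ qPow* (isTarget h) (walkPoly b (h ℤ.+ 1ℤ))
walkPoly-above-ceiling b k = sym (trans
  (qPow*-cong {isTarget h} refl (walkPoly-unreachable b (h ℤ.+ 1ℤ) (ceiling-unreachable b)) k)
  (qPow*-zeroP (isTarget h) k))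
  where h = finalHeight 0 (suc b)

walkPoly-cong : ∀ {n n′ h h′} → n ≡ n′ → h ≡ h′ → walkPoly n h ≗ walkPoly n′ h′
walkPoly-cong refl refl k = refl

leftTerm-walkPoly : ∀ a b → g a b ≗ walkPoly (a + b) (finalHeight a b) →
                    let h = finalHeight (suc a) b in
                    qPow* (dexp (suc a) b) (g a b) ≗ qPow* (isTarget h) (walkPoly (a + b) (h ℤ.+ 1ℤ))
leftTerm-walkPoly a b g≗walk = qPow*-cong (dexp≡isTarget a b)
  (λ k → trans (g≗walk k) (walkPoly-cong {a + b} refl (sym (finalHeight-predˡ a b)) k))

rightTerm-walkPoly : ∀ a b → g a b ≗ walkPoly (a + b) (finalHeight a b) →
                     g a b ≗ walkPoly (a + b) (finalHeight a (suc b) ℤ.- 1ℤ)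
rightTerm-walkPoly a b g≗walk k =
  trans (g≗walk k) (walkPoly-cong {a + b} refl (sym (finalHeight-predʳ a b)) k)

g≗walkPoly : ∀ a b → g a b ≗ walkPoly (a + b) (finalHeight a b)
g≗walkPoly zero    zero    k = sym (ℕP.+-identityʳ _)
g≗walkPoly (suc a) zero    = begin
  qPow* (dexp (suc a) 0) (g a 0) +P zeroP
    ≈⟨ +P-cong (leftTerm-walkPoly a 0 (g≗walkPoly a 0)) (walkPoly-below-floor a) ⟩
  qPow* (isTarget h) (walkPoly (a + 0) (h ℤ.+ 1ℤ)) +P walkPoly (a + 0) (h ℤ.- 1ℤ)
    ≈⟨ walkPoly-suc (a + 0) h ⟨
  walkPoly (suc a + 0) h
    ∎
  where open SetoidReasoning (ℕ →-setoid ℕ)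
        h = finalHeight (suc a) 0
g≗walkPoly zero    (suc b) = begin
  zeroP +P g 0 b
    ≈⟨ +P-cong (walkPoly-above-ceiling b) (rightTerm-walkPoly 0 b (g≗walkPoly 0 b)) ⟩
  qPow* (isTarget h) (walkPoly b (h ℤ.+ 1ℤ)) +P walkPoly b (h ℤ.- 1ℤ)
    ≈⟨ walkPoly-suc b h ⟨
  walkPoly (suc b) h
    ∎
  where open SetoidReasoning (ℕ →-setoid ℕ)
        h = finalHeight 0 (suc b)
g≗walkPoly (suc a) (suc b) = begin
  qPow* (dexp (suc a) (suc b)) (g a (suc b)) +P g (suc a) b
    ≈⟨ +P-cong (leftTerm-walkPoly a (suc b) (g≗walkPoly a (suc b)))
               (λ k → trans (rightTerm-walkPoly (suc a) b (g≗walkPoly (suc a) b) k)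
                            (walkPoly-cong (sym (ℕP.+-suc a b)) refl k)) ⟩
  qPow* (isTarget h) (walkPoly (a + suc b) (h ℤ.+ 1ℤ)) +P walkPoly (a + suc b) (h ℤ.- 1ℤ)
    ≈⟨ walkPoly-suc (a + suc b) h ⟨
  walkPoly (suc a + suc b) h
    ∎
  where open SetoidReasoning (ℕ →-setoid ℕ)
        h = finalHeight (suc a) (suc b)

mainTheorem3 : (m₁ m₂ : ℕ) →
    Σ (SPath m₁ m₂ ⤖ LPath m₁ m₂)
      (λ f → (s : SPath m₁ m₂) → NW (proj₁ (Bijection.to f s)) ≡ sWeight s)
    × ((k : ℕ) → g m₁ m₂ k ≡ pathSum m₁ m₂ k)
mainTheorem3 m₁ m₂ =
  (SPath⤖LPath , NW-latticePath) ,
  λ k → trans (g≗walkPoly m₁ m₂ k) (sym (pathSum≗walkPoly m₁ m₂ k))
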